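{- For every integer $n\ge 1$, \[ C_n = 2^{n-1}+\sum_{k=1}^{n-2}\frac{2^{k}}{n-k}\binom{2n-2k}{n-2-k}, \] where $C_n=\frac{1}{n+1}\binom{2n}{n}$ is the $n$-th Catalan number (the sum is empty for $n\le 2$). -}

module Defs where

open import Data.Nat using (ℕ; zero; suc; _+_; _∸_; _*_; _^_)
open import Data.Nat.Combinatorics using (_C_)
open import Data.Integer using (+_)
open import Data.Rational using (ℚ; _/_)
import Data.Rational as ℚ
open import Data.List using (List; map; foldr; upTo)

ι : ℕ → ℚ
ι m = (+ m) / 1

sumℚ : List ℚ → ℚ
sumℚ = foldr ℚ._+_ ℚ.0ℚ

-- Σ_{k=a}^{b} f k  (empty when b < a); here: list [a, ..., b]
range : ℕ → ℕ → List ℕ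
range a b = map (λ i → a + i) (upTo (suc b ∸ a))

catalan : ℕ → ℚ
catalan n = ι ((2 * n) C n) ℚ.* ((+ 1) / suc n)

-- term of the sum: 2^k / (n-k) * binom(2n-2k, n-2-k).
-- In the sum 1 ≤ k ≤ n-2 < n, so n - k = suc (n ∸ suc k); written this way
-- so that the denominator is syntactically nonzero.
term : ℕ → ℕ → ℚ
term n k = ι (2 ^ k) ℚ.* ((+ 1) / suc (n ∸ suc k)) ℚ.* ι ((2 * n ∸ 2 * k) C (n ∸ 2 ∸ k))

{-# OPTIONS --safe #-}
-- Let S n be the sum. Shifting its index gives S (n + 1) = 2 S n + (2 / n) binom(2n, n - 2) for n ≥ 2.
-- The ratio identities binom(2n + 2, n + 1) (n + 1) = 2 (2n + 1) binom(2n, n) and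
-- binom(2n, n - 2) (n + 1) (n + 2) = n (n - 1) binom(2n, n) give the same recurrence
-- C (n + 1) = 2 C n + (2 / n) binom(2n, n - 2) for the Catalan numbers. Hence both sides of the identity
-- satisfy f (n + 1) = 2 f n + (2 / n) binom(2n, n - 2) for n ≥ 2, and they agree at n = 1 and n = 2.
module Submission where

open import Defs
open import Data.Integer as ℤ using (+_)
import Data.Integer.Properties as ℤ
open import Data.List using (map; applyUpTo; upTo)
open import Data.List.Properties using (map-∘; map-applyUpTo)
open import Data.Nat using (ℕ; zero; suc; _+_; _*_; _∸_; _^_; _≤_; _≥_; _!; s≤s; s<s; _<?_; _≤?_)
open import Data.Nat.Combinatorics
  using (_C_; nCk+nC[k+1]≡[n+1]C[k+1]; k![n∸k]!∣n!; [n-k]*[n-k-1]!≡[n-k]!)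
open import Data.Nat.Combinatorics.Specification using (nCk≡n!/k![n-k]!; k>n⇒nCk≡0)
open import Data.Nat.DivMod using (m/n*n≡m)
open import Data.Nat.Properties
open import Algebra.Properties.CommutativeSemigroup *-commutativeSemigroup using (xy∙z≈xz∙y; xy∙z≈x∙zy)
open import Data.Nat.Tactic.RingSolver using (solve-∀)
open import Data.Rational using (ℚ; 0ℚ; 1ℚ; _/_; toℚᵘ)
import Data.Rational as ℚ
import Data.Rational.Properties as ℚ
open import Data.Rational.Unnormalised as ℚᵘ using (mkℚᵘ; *≡*)
import Data.Rational.Unnormalised.Properties as ℚᵘ
open import Function using (_∘_; id)
open import Relation.Binary.PropositionalEquality
open import Relation.Nullary using (yes; no)
open import Relation.Nullary.Decidable using (dec⇒maybe)
open import Tactic.RingSolver.Core.AlmostCommutativeRing using (AlmostCommutativeRing; fromCommutativeRing)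
import Tactic.RingSolver as RingSolver

toℚᵘ-ι : ∀ m → toℚᵘ (ι m) ℚᵘ.≃ mkℚᵘ (+ m) 0
toℚᵘ-ι m = ℚ.toℚᵘ-fromℚᵘ (mkℚᵘ (+ m) 0)

ι-homo-+ : ∀ m n → ι (m + n) ≡ ι m ℚ.+ ι n
ι-homo-+ m n = ℚ.toℚᵘ-injective (begin
  toℚᵘ (ι (m + n))                ≈⟨ toℚᵘ-ι (m + n) ⟩
  mkℚᵘ (+ (m + n)) 0              ≈⟨ *≡* (cong (ℤ._* + 1) numerators) ⟩
  mkℚᵘ (+ m) 0 ℚᵘ.+ mkℚᵘ (+ n) 0  ≈⟨ ℚᵘ.+-cong (toℚᵘ-ι m) (toℚᵘ-ι n) ⟨
  toℚᵘ (ι m) ℚᵘ.+ toℚᵘ (ι n)      ≈⟨ ℚ.toℚᵘ-homo-+ (ι m) (ι n) ⟨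
  toℚᵘ (ι m ℚ.+ ι n)              ∎)
  where
  open ℚᵘ.≃-Reasoning
  numerators : + (m + n) ≡ + m ℤ.* + 1 ℤ.+ + n ℤ.* + 1
  numerators = trans (ℤ.pos-+ m n) (sym (cong₂ ℤ._+_ (ℤ.*-identityʳ (+ m)) (ℤ.*-identityʳ (+ n))))

ι-homo-* : ∀ m n → ι (m * n) ≡ ι m ℚ.* ι n
ι-homo-* m n = ℚ.toℚᵘ-injective (begin
  toℚᵘ (ι (m * n))                ≈⟨ toℚᵘ-ι (m * n) ⟩
  mkℚᵘ (+ (m * n)) 0              ≈⟨ *≡* (cong (ℤ._* + 1) (ℤ.pos-* m n)) ⟩
  mkℚᵘ (+ m) 0 ℚᵘ.* mkℚᵘ (+ n) 0  ≈⟨ ℚᵘ.*-cong (toℚᵘ-ι m) (toℚᵘ-ι n) ⟨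
  toℚᵘ (ι m) ℚᵘ.* toℚᵘ (ι n)      ≈⟨ ℚ.toℚᵘ-homo-* (ι m) (ι n) ⟨
  toℚᵘ (ι m ℚ.* ι n)              ∎)
  where open ℚᵘ.≃-Reasoning

ι[1+n]*1/[1+n]≡1 : ∀ n → ι (suc n) ℚ.* ((+ 1) / suc n) ≡ 1ℚ
ι[1+n]*1/[1+n]≡1 n = ℚ.toℚᵘ-injective (begin
  toℚᵘ (ι (suc n) ℚ.* ((+ 1) / suc n))
    ≈⟨ ℚ.toℚᵘ-homo-* (ι (suc n)) ((+ 1) / suc n) ⟩
  toℚᵘ (ι (suc n)) ℚᵘ.* toℚᵘ ((+ 1) / suc n)
    ≈⟨ ℚᵘ.*-cong (toℚᵘ-ι (suc n)) (ℚ.toℚᵘ-fromℚᵘ (mkℚᵘ (+ 1) n)) ⟩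
  mkℚᵘ (+ suc n) 0 ℚᵘ.* mkℚᵘ (+ 1) n
    ≈⟨ ℚᵘ.*-inverseʳ (mkℚᵘ (+ suc n) 0) ⟩
  ℚᵘ.1ℚᵘ
    ∎)
  where open ℚᵘ.≃-Reasoning

open ≡-Reasoning

m≡n+o⇒m∸n≡o : ∀ {m} n {o} → m ≡ n + o → m ∸ n ≡ o
m≡n+o⇒m∸n≡o n {o} refl = m+n∸m≡n n o

nCk*k![n∸k]!≡n! : ∀ {n k} → k ≤ n → (n C k) * (k ! * (n ∸ k) !) ≡ n !
nCk*k![n∸k]!≡n! {n} {k} k≤n = trans (cong (_* (k ! * (n ∸ k) !)) (nCk≡n!/k![n-k]! k≤n))
                                    (m/n*n≡m {{k !* (n ∸ k) !≢0}} (k![n∸k]!∣n! k≤n))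

nC[1+k]*[1+k]≡nCk*[n∸k] : ∀ n k → (n C suc k) * suc k ≡ (n C k) * (n ∸ k)
nC[1+k]*[1+k]≡nCk*[n∸k] n k with k <? n
... | yes k<n = *-cancelʳ-≡ _ _ (k ! * (n ∸ suc k) !) {{k !* (n ∸ suc k) !≢0}} (begin
  (n C suc k) * suc k * (k ! * (n ∸ suc k) !)  ≡⟨ regroup (n C suc k) (suc k) (k !) ((n ∸ suc k) !) ⟩
  (n C suc k) * (suc k ! * (n ∸ suc k) !)      ≡⟨ nCk*k![n∸k]!≡n! k<n ⟩
  n !                                          ≡⟨ nCk*k![n∸k]!≡n! (<⇒≤ k<n) ⟨
  (n C k) * (k ! * (n ∸ k) !)                  ≡⟨ cong (λ f → (n C k) * (k ! * f)) ([n-k]*[n-k-1]!≡[n-k]! k<n) ⟨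
  (n C k) * (k ! * ((n ∸ k) * (n ∸ suc k) !))  ≡⟨ regroup′ (n C k) (k !) (n ∸ k) ((n ∸ suc k) !) ⟩
  (n C k) * (n ∸ k) * (k ! * (n ∸ suc k) !)    ∎)
  where
  regroup : ∀ c s f g → c * s * (f * g) ≡ c * (s * f * g)
  regroup = solve-∀
  regroup′ : ∀ c f d g → c * (f * (d * g)) ≡ c * d * (f * g)
  regroup′ = solve-∀
... | no k≮n = begin
  (n C suc k) * suc k  ≡⟨ cong (_* suc k) (k>n⇒nCk≡0 (s≤s n≤k)) ⟩
  0                    ≡⟨ *-zeroʳ (n C k) ⟨
  (n C k) * 0          ≡⟨ cong ((n C k) *_) (m≤n⇒m∸n≡0 n≤k) ⟨
  (n C k) * (n ∸ k)    ∎
  where n≤k = ≮⇒≥ k≮n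

[1+n]C[1+k]*[1+k]≡[1+n]*nCk : ∀ n k → (suc n C suc k) * suc k ≡ suc n * (n C k)
[1+n]C[1+k]*[1+k]≡[1+n]*nCk n k with k ≤? n
... | yes k≤n = begin
  (suc n C suc k) * suc k                ≡⟨ cong (_* suc k) (nCk+nC[k+1]≡[n+1]C[k+1] n k) ⟨
  ((n C k) + (n C suc k)) * suc k        ≡⟨ *-distribʳ-+ (suc k) (n C k) (n C suc k) ⟩
  (n C k) * suc k + (n C suc k) * suc k  ≡⟨ cong (λ x → (n C k) * suc k + x) (nC[1+k]*[1+k]≡nCk*[n∸k] n k) ⟩
  (n C k) * suc k + (n C k) * (n ∸ k)    ≡⟨ *-distribˡ-+ (n C k) (suc k) (n ∸ k) ⟨
  (n C k) * suc (k + (n ∸ k))            ≡⟨ cong (λ m → (n C k) * suc m) (m+[n∸m]≡n k≤n) ⟩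
  (n C k) * suc n                        ≡⟨ *-comm (n C k) (suc n) ⟩
  suc n * (n C k)                        ∎
... | no k≰n = begin
  (suc n C suc k) * suc k  ≡⟨ cong (_* suc k) (k>n⇒nCk≡0 (s<s n<k)) ⟩
  0                        ≡⟨ *-zeroʳ (suc n) ⟨
  suc n * 0                ≡⟨ cong (suc n *_) (k>n⇒nCk≡0 n<k) ⟨
  suc n * (n C k)          ∎
  where n<k = ≰⇒> k≰n

[1+n]Ck*[1+n∸k]≡[1+n]*nCk : ∀ n k → (suc n C k) * (suc n ∸ k) ≡ suc n * (n C k)
[1+n]Ck*[1+n∸k]≡[1+n]*nCk n k =
  trans (sym (nC[1+k]*[1+k]≡nCk*[n∸k] (suc n) k)) ([1+n]C[1+k]*[1+k]≡[1+n]*nCk n k)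

[2+2n]C[1+n]*[1+n]≡2[1+2n]*[2n]Cn : ∀ n →
  ((2 * suc n) C suc n) * suc n ≡ 2 * suc (2 * n) * ((2 * n) C n)
[2+2n]C[1+n]*[1+n]≡2[1+2n]*[2n]Cn n = *-cancelʳ-≡ _ _ (suc n) (begin
  ((2 * suc n) C suc n) * suc n * suc n    ≡⟨ cong (λ l → (l C suc n) * suc n * suc n) (*-suc 2 n) ⟩
  (suc m C suc n) * suc n * suc n          ≡⟨ cong (_* suc n) ([1+n]C[1+k]*[1+k]≡[1+n]*nCk m n) ⟩
  suc m * (m C n) * suc n                  ≡⟨ *-assoc (suc m) (m C n) (suc n) ⟩
  suc m * ((m C n) * suc n)                ≡⟨ cong (λ l → suc m * ((m C n) * l)) m∸n≡1+n ⟨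
  suc m * ((m C n) * (m ∸ n))              ≡⟨ cong (suc m *_) ([1+n]Ck*[1+n∸k]≡[1+n]*nCk (2 * n) n) ⟩
  suc m * (m * ((2 * n) C n))              ≡⟨ regroup n ((2 * n) C n) ⟩
  2 * suc (2 * n) * ((2 * n) C n) * suc n  ∎)
  where
  m = suc (2 * n)
  split : ∀ k → suc (2 * k) ≡ k + suc k
  split = solve-∀
  m∸n≡1+n : m ∸ n ≡ suc n
  m∸n≡1+n = m≡n+o⇒m∸n≡o n (split n)
  regroup : ∀ k a → suc (suc (2 * k)) * (suc (2 * k) * a) ≡ 2 * suc (2 * k) * a * suc k
  regroup = solve-∀

[2n]C[n∸2]*[n+1]*[n+2]≡[2n]Cn*n*[n∸1] : ∀ p → let n = 2 + p in
  ((2 * n) C p) * suc n * suc (suc n) ≡ ((2 * n) C n) * n * suc p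
[2n]C[n∸2]*[n+1]*[n+2]≡[2n]Cn*n*[n∸1] p = begin
  ((2 * n) C p) * suc n * suc (suc n)          ≡⟨ xy∙z≈xz∙y ((2 * n) C p) (suc n) (suc (suc n)) ⟩
  ((2 * n) C p) * suc (suc n) * suc n          ≡⟨ cong (λ l → ((2 * n) C p) * l * suc n) [2n]∸p≡n+2 ⟨
  ((2 * n) C p) * (2 * n ∸ p) * suc n          ≡⟨ cong (_* suc n) (nC[1+k]*[1+k]≡nCk*[n∸k] (2 * n) p) ⟨
  ((2 * n) C suc p) * suc p * suc n            ≡⟨ xy∙z≈xz∙y ((2 * n) C suc p) (suc p) (suc n) ⟩
  ((2 * n) C suc p) * suc n * suc p            ≡⟨ cong (λ l → ((2 * n) C suc p) * l * suc p) [2n]∸[p+1]≡n+1 ⟨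
  ((2 * n) C suc p) * (2 * n ∸ suc p) * suc p  ≡⟨ cong (_* suc p) (nC[1+k]*[1+k]≡nCk*[n∸k] (2 * n) (suc p)) ⟨
  ((2 * n) C n) * n * suc p                    ∎
  where
  n = 2 + p
  split₂ : ∀ q → 2 * (2 + q) ≡ q + (4 + q)
  split₂ = solve-∀
  split₁ : ∀ q → 2 * (2 + q) ≡ suc q + (3 + q)
  split₁ = solve-∀
  [2n]∸p≡n+2 : 2 * n ∸ p ≡ suc (suc n)
  [2n]∸p≡n+2 = m≡n+o⇒m∸n≡o p (split₂ p)
  [2n]∸[p+1]≡n+1 : 2 * n ∸ suc p ≡ suc n
  [2n]∸[p+1]≡n+1 = m≡n+o⇒m∸n≡o (suc p) (split₁ p)

catalan-step-cleared : ∀ p → let n = 2 + p in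
  n * suc n * ((2 * suc n) C suc n)
    ≡ 2 * n * suc (suc n) * ((2 * n) C n) + 2 * suc n * suc (suc n) * ((2 * n) C p)
catalan-step-cleared p = begin
  n * suc n * D
    ≡⟨ xy∙z≈x∙zy n (suc n) D ⟩
  n * (D * suc n)
    ≡⟨ cong (n *_) ([2+2n]C[1+n]*[1+n]≡2[1+2n]*[2n]Cn n) ⟩
  n * (2 * suc (2 * n) * A)
    ≡⟨ split p A ⟩
  2 * n * suc (suc n) * A + 2 * (A * n * suc p)
    ≡⟨ cong (λ x → 2 * n * suc (suc n) * A + 2 * x) ([2n]C[n∸2]*[n+1]*[n+2]≡[2n]Cn*n*[n∸1] p) ⟨
  2 * n * suc (suc n) * A + 2 * (B * suc n * suc (suc n))
    ≡⟨ cong (λ x → 2 * n * suc (suc n) * A + x) (regroup B (suc n) (suc (suc n))) ⟩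
  2 * n * suc (suc n) * A + 2 * suc n * suc (suc n) * B
    ∎
  where
  n = 2 + p
  A = (2 * n) C n
  B = (2 * n) C p
  D = (2 * suc n) C suc n
  split : ∀ q a →
    (2 + q) * (2 * suc (2 * (2 + q)) * a) ≡ 2 * (2 + q) * (4 + q) * a + 2 * (a * (2 + q) * suc q)
  split = solve-∀
  regroup : ∀ b y z → 2 * (b * y * z) ≡ 2 * y * z * b
  regroup = solve-∀

ℚ-ring : AlmostCommutativeRing _ _
ℚ-ring = fromCommutativeRing ℚ.+-*-commutativeRing (λ x → dec⇒maybe (0ℚ ℚ.≟ x))

clear-denominators : ∀ t x y z a b c D A B →
  x ℚ.* a ≡ 1ℚ → y ℚ.* b ≡ 1ℚ → z ℚ.* c ≡ 1ℚ →
  x ℚ.* y ℚ.* D ≡ t ℚ.* x ℚ.* z ℚ.* A ℚ.+ t ℚ.* y ℚ.* z ℚ.* B →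
  D ℚ.* c ≡ t ℚ.* (A ℚ.* b) ℚ.+ t ℚ.* a ℚ.* B
clear-denominators t x y z a b c D A B xa≡1 yb≡1 zc≡1 cleared = begin
  D ℚ.* c
    ≡⟨ cancel xa≡1 yb≡1 (D ℚ.* c) ⟨
  x ℚ.* a ℚ.* (y ℚ.* b) ℚ.* (D ℚ.* c)
    ≡⟨ collect x y a b c D ⟩
  x ℚ.* y ℚ.* D ℚ.* (a ℚ.* b ℚ.* c)
    ≡⟨ cong (ℚ._* (a ℚ.* b ℚ.* c)) cleared ⟩
  (t ℚ.* x ℚ.* z ℚ.* A ℚ.+ t ℚ.* y ℚ.* z ℚ.* B) ℚ.* (a ℚ.* b ℚ.* c)
    ≡⟨ distribute t x y z a b c A B ⟩
  x ℚ.* a ℚ.* (z ℚ.* c) ℚ.* (t ℚ.* (A ℚ.* b)) ℚ.+ y ℚ.* b ℚ.* (z ℚ.* c) ℚ.* (t ℚ.* a ℚ.* B)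
    ≡⟨ cong₂ ℚ._+_ (cancel xa≡1 zc≡1 (t ℚ.* (A ℚ.* b))) (cancel yb≡1 zc≡1 (t ℚ.* a ℚ.* B)) ⟩
  t ℚ.* (A ℚ.* b) ℚ.+ t ℚ.* a ℚ.* B
    ∎
  where
  cancel : ∀ {u v} → u ≡ 1ℚ → v ≡ 1ℚ → ∀ w → u ℚ.* v ℚ.* w ≡ w
  cancel refl refl = ℚ.*-identityˡ
  collect : ∀ x y a b c D →
    x ℚ.* a ℚ.* (y ℚ.* b) ℚ.* (D ℚ.* c) ≡ x ℚ.* y ℚ.* D ℚ.* (a ℚ.* b ℚ.* c)
  collect = RingSolver.solve-∀ ℚ-ring
  distribute : ∀ t x y z a b c A B →
    (t ℚ.* x ℚ.* z ℚ.* A ℚ.+ t ℚ.* y ℚ.* z ℚ.* B) ℚ.* (a ℚ.* b ℚ.* c)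
      ≡ x ℚ.* a ℚ.* (z ℚ.* c) ℚ.* (t ℚ.* (A ℚ.* b)) ℚ.+ y ℚ.* b ℚ.* (z ℚ.* c) ℚ.* (t ℚ.* a ℚ.* B)
  distribute = RingSolver.solve-∀ ℚ-ring

catalan-step : ∀ p → let n = 2 + p in catalan (suc n) ≡ ι 2 ℚ.* catalan n ℚ.+ term (suc n) 1
catalan-step p = begin
  ι D ℚ.* ((+ 1) / suc (suc n))
    ≡⟨ clear-denominators (ι 2) (ι n) (ι (suc n)) (ι (2 + n))
                          ((+ 1) / n) ((+ 1) / suc n) ((+ 1) / suc (suc n)) (ι D) (ι A) (ι B)
                          (ι[1+n]*1/[1+n]≡1 (suc p)) (ι[1+n]*1/[1+n]≡1 n) (ι[1+n]*1/[1+n]≡1 (suc n))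
                          cleared ⟩
  ι 2 ℚ.* (ι A ℚ.* ((+ 1) / suc n)) ℚ.+ ι 2 ℚ.* ((+ 1) / n) ℚ.* ι B
    ≡⟨ cong (λ l → ι 2 ℚ.* catalan n ℚ.+ ι 2 ℚ.* ((+ 1) / n) ℚ.* ι (l C p)) (cong (_∸ 2) (*-suc 2 n)) ⟨
  ι 2 ℚ.* catalan n ℚ.+ term (suc n) 1
    ∎
  where
  n = 2 + p
  A = (2 * n) C n
  B = (2 * n) C p
  D = (2 * suc n) C suc n
  ι-*³ : ∀ a b c → ι (a * b * c) ≡ ι a ℚ.* ι b ℚ.* ι c
  ι-*³ a b c = trans (ι-homo-* (a * b) c) (cong (ℚ._* ι c) (ι-homo-* a b))
  ι-*⁴ : ∀ a b c d → ι (a * b * c * d) ≡ ι a ℚ.* ι b ℚ.* ι c ℚ.* ι d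
  ι-*⁴ a b c d = trans (ι-homo-* (a * b * c) d) (cong (ℚ._* ι d) (ι-*³ a b c))
  cleared : ι n ℚ.* ι (suc n) ℚ.* ι D
    ≡ ι 2 ℚ.* ι n ℚ.* ι (2 + n) ℚ.* ι A ℚ.+ ι 2 ℚ.* ι (suc n) ℚ.* ι (2 + n) ℚ.* ι B
  cleared = begin
    ι n ℚ.* ι (suc n) ℚ.* ι D
      ≡⟨ ι-*³ n (suc n) D ⟨
    ι (n * suc n * D)
      ≡⟨ cong ι (catalan-step-cleared p) ⟩
    ι (2 * n * (2 + n) * A + 2 * suc n * (2 + n) * B)
      ≡⟨ ι-homo-+ (2 * n * (2 + n) * A) (2 * suc n * (2 + n) * B) ⟩
    ι (2 * n * (2 + n) * A) ℚ.+ ι (2 * suc n * (2 + n) * B)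
      ≡⟨ cong₂ ℚ._+_ (ι-*⁴ 2 n (2 + n) A) (ι-*⁴ 2 (suc n) (2 + n) B) ⟩
    ι 2 ℚ.* ι n ℚ.* ι (2 + n) ℚ.* ι A ℚ.+ ι 2 ℚ.* ι (suc n) ℚ.* ι (2 + n) ℚ.* ι B
      ∎

termSum : ℕ → ℚ
termSum n = sumℚ (map (term n) (range 1 (n ∸ 2)))

sumℚ-map-range : ∀ f b → sumℚ (map f (range 1 b)) ≡ sumℚ (applyUpTo (f ∘ suc) b)
sumℚ-map-range f b = cong sumℚ (trans (sym (map-∘ (upTo b))) (map-applyUpTo id (f ∘ suc) b))

sumℚ-applyUpTo-scale : ∀ c f g n → (∀ i → f i ≡ c ℚ.* g i) →
  sumℚ (applyUpTo f n) ≡ c ℚ.* sumℚ (applyUpTo g n)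
sumℚ-applyUpTo-scale c f g zero    f≡cg = sym (ℚ.*-zeroʳ c)
sumℚ-applyUpTo-scale c f g (suc n) f≡cg = begin
  f 0 ℚ.+ sumℚ (applyUpTo (f ∘ suc) n)
    ≡⟨ cong₂ ℚ._+_ (f≡cg 0) (sumℚ-applyUpTo-scale c (f ∘ suc) (g ∘ suc) n (f≡cg ∘ suc)) ⟩
  c ℚ.* g 0 ℚ.+ c ℚ.* sumℚ (applyUpTo (g ∘ suc) n)
    ≡⟨ ℚ.*-distribˡ-+ c (g 0) (sumℚ (applyUpTo (g ∘ suc) n)) ⟨
  c ℚ.* (g 0 ℚ.+ sumℚ (applyUpTo (g ∘ suc) n))
    ∎

term[1+n][2+k]≡2*term[n][1+k] : ∀ n k → term (suc n) (2 + k) ≡ ι 2 ℚ.* term n (suc k)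
term[1+n][2+k]≡2*term[n][1+k] n k = begin
  term (suc n) (2 + k)               ≡⟨ cong₂ (λ l m → ι (2 ^ (2 + k)) ℚ.* w ℚ.* ι (l C m)) width lower ⟩
  ι (2 * 2 ^ suc k) ℚ.* w ℚ.* b      ≡⟨ cong (λ u → u ℚ.* w ℚ.* b) (ι-homo-* 2 (2 ^ suc k)) ⟩
  ι 2 ℚ.* ι (2 ^ suc k) ℚ.* w ℚ.* b  ≡⟨ regroup (ι 2) (ι (2 ^ suc k)) w b ⟩
  ι 2 ℚ.* term n (suc k)             ∎
  where
  w = (+ 1) / suc (n ∸ suc (suc k))
  b = ι ((2 * n ∸ 2 * suc k) C (n ∸ 2 ∸ suc k))
  width : 2 * suc n ∸ 2 * (2 + k) ≡ 2 * n ∸ 2 * suc k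
  width = cong₂ _∸_ (*-suc 2 n) (*-suc 2 (suc k))
  lower : suc n ∸ 2 ∸ (2 + k) ≡ n ∸ 2 ∸ suc k
  lower = trans (∸-+-assoc (suc n) 2 (2 + k)) (sym (∸-+-assoc n 2 (suc k)))
  regroup : ∀ t x y z → t ℚ.* x ℚ.* y ℚ.* z ≡ t ℚ.* (x ℚ.* y ℚ.* z)
  regroup = RingSolver.solve-∀ ℚ-ring

termSum-step : ∀ p → termSum (3 + p) ≡ term (3 + p) 1 ℚ.+ ι 2 ℚ.* termSum (2 + p)
termSum-step p = begin
  termSum (3 + p)
    ≡⟨ sumℚ-map-range (term (3 + p)) (suc p) ⟩
  term (3 + p) 1 ℚ.+ sumℚ (applyUpTo (term (3 + p) ∘ suc ∘ suc) p)
    ≡⟨ cong (term (3 + p) 1 ℚ.+_) shifted ⟩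
  term (3 + p) 1 ℚ.+ ι 2 ℚ.* sumℚ (applyUpTo (term (2 + p) ∘ suc) p)
    ≡⟨ cong (λ s → term (3 + p) 1 ℚ.+ ι 2 ℚ.* s) (sumℚ-map-range (term (2 + p)) p) ⟨
  term (3 + p) 1 ℚ.+ ι 2 ℚ.* termSum (2 + p)
    ∎
  where
  shifted : sumℚ (applyUpTo (term (3 + p) ∘ suc ∘ suc) p)
          ≡ ι 2 ℚ.* sumℚ (applyUpTo (term (2 + p) ∘ suc) p)
  shifted = sumℚ-applyUpTo-scale (ι 2) _ _ p (term[1+n][2+k]≡2*term[n][1+k] (2 + p))

catalan[1+n]≡2^n+termSum[1+n] : ∀ n → catalan (suc n) ≡ ι (2 ^ n) ℚ.+ termSum (suc n)
catalan[1+n]≡2^n+termSum[1+n] zero          = refl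
catalan[1+n]≡2^n+termSum[1+n] (suc zero)    = refl
catalan[1+n]≡2^n+termSum[1+n] (suc (suc p)) = begin
  catalan (3 + p)
    ≡⟨ catalan-step p ⟩
  ι 2 ℚ.* catalan (2 + p) ℚ.+ term (3 + p) 1
    ≡⟨ cong (λ c → ι 2 ℚ.* c ℚ.+ term (3 + p) 1) (catalan[1+n]≡2^n+termSum[1+n] (suc p)) ⟩
  ι 2 ℚ.* (ι (2 ^ suc p) ℚ.+ termSum (2 + p)) ℚ.+ term (3 + p) 1
    ≡⟨ regroup (ι 2) (ι (2 ^ suc p)) (termSum (2 + p)) (term (3 + p) 1) ⟩
  ι 2 ℚ.* ι (2 ^ suc p) ℚ.+ (term (3 + p) 1 ℚ.+ ι 2 ℚ.* termSum (2 + p))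
    ≡⟨ cong₂ ℚ._+_ (ι-homo-* 2 (2 ^ suc p)) (termSum-step p) ⟨
  ι (2 ^ (2 + p)) ℚ.+ termSum (3 + p)
    ∎
  where
  regroup : ∀ t x s u → t ℚ.* (x ℚ.+ s) ℚ.+ u ≡ t ℚ.* x ℚ.+ (u ℚ.+ t ℚ.* s)
  regroup = RingSolver.solve-∀ ℚ-ring

proposition14 : (n : ℕ) → n ≥ 1 →
    catalan n ≡ ι (2 ^ (n ∸ 1)) ℚ.+ sumℚ (map (term n) (range 1 (n ∸ 2)))
proposition14 (suc n) _ = catalan[1+n]≡2^n+termSum[1+n] n
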